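{- On input $n,m,\sigma$, the following randomized procedure outputs a uniformly distributed element of $\mathcal D_{n,m,\sigma}$. (1) Repeatedly take a uniformly random permutation of the bit string $1^m0^{n\sigma-m}$ and reshape it column by column into an $n\times\sigma$ matrix $O$ (the $j$-th column consisting of positions $(j-1)n+1,\dots,jn$), until every column of $O$ contains at least one $1$. (2) Form the mask string $1\#^{\|O_1\|-1}1\#^{\|O_2\|-1}\cdots1\#^{\|O_\sigma\|-1}$ of length $m$, take a uniformly random permutation $b$ of $1^{n-\sigma-1}0^{m-n+1}$, and let $I\in\{0,1\}^m$ be obtained from the mask by replacing its $\#$ symbols, from left to right, by $b_1,b_2,\dots,b_{m-\sigma}$. (3) Output the automaton $([n],[\sigma],\delta)$ where $\delta$ is computed as: set $\delta=\emptyset$, $i=1$, $v=1$; for $j=1,\dots,\sigma$ and, inside, for $u=1,\dots,n$: if $O_{u,j}=1$ then (if $I_i=1$ set $v:=v+1$), add the transition $\delta(u,j)=v$, and set $i:=i+1$.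
   Context: For a positive integer $k$, $[k]=\{1,\dots,k\}$. For a 0/1 vector $x$, $\|x\|$ is its number of ones; $O_j$ denotes the $j$-th column of a matrix $O$. A DFA is a triple $D=(Q,\Sigma,\delta)$ with $Q=[n]$, source state $1$, alphabet $\Sigma=[\sigma]$ ordered as integers, and partial transition function $\delta:Q\times\Sigma\to Q$; $m$ is the number of pairs on which $\delta$ is defined. DFAs are assumed to satisfy: state $v$ has an incoming transition iff $v>1$. A WDFA (w.r.t. order $1<\dots<n$) satisfies: (i) if $u'=\delta(u,a)$, $v'=\delta(v,a')$ and $a<a'$ then $u'<v'$; (ii) if $u'=\delta(u,a)\ne\delta(v,a)=v'$ and $u<v$ then $u'<v'$. $\mathcal D_{n,m,\sigma}$ is the set of WDFAs with states $[n]$, exactly $m$ transitions, effective alphabet $[\sigma]$ (every letter labels some transition), and Wheeler order $1<\dots<n$. Standing assumptions: $n-1\le m\le n\sigma$, $\sigma\le n-1$. -}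

module Defs where

open import Data.Nat using (ℕ; zero; suc; _+_; _*_; _∸_; _≤_; _<_; _≡ᵇ_)
open import Data.Bool using (Bool; true; false; if_then_else_; _∧_)
open import Data.List using (List; []; _∷_; length; take; drop; _++_)
open import Data.List.Relation.Unary.All using (All)
open import Data.Maybe using (Maybe; just; nothing)
open import Data.Product using (Σ; _×_; _,_; ∃)
open import Data.Fin using (Fin; toℕ)
open import Data.Vec using (Vec; lookup; tabulate)
open import Relation.Binary.PropositionalEquality using (_≡_; _≢_)

ones : List Bool → ℕ
ones []          = 0
ones (true ∷ x)  = suc (ones x)
ones (false ∷ x) = ones x

columns : ℕ → ℕ → List Bool → List (List Bool)
columns n zero    w = []
columns n (suc k) w = take n w ∷ columns n k (drop n w)

-- DFAs over states [n] and alphabet [σ], as transition tables.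
-- Row u (Fin n, representing state toℕ u + 1), column a (Fin σ,
-- representing letter toℕ a + 1); entry = δ(u,a) (a state in ℕ), or
-- nothing if undefined.

Table : ℕ → ℕ → Set
Table n σ = Vec (Vec (Maybe ℕ) σ) n

entry : ∀ {n σ} → Table n σ → Fin n → Fin σ → Maybe ℕ
entry T u a = lookup (lookup T u) a

defined : Maybe ℕ → ℕ
defined (just _) = 1
defined nothing  = 0

sumV : ∀ {k} → Vec ℕ k → ℕ
sumV Vec.[]       = 0
sumV (x Vec.∷ xs) = x + sumV xs

numTrans : ∀ {n σ} → Table n σ → ℕ
numTrans T = sumV (Data.Vec.map (λ row → sumV (Data.Vec.map defined row)) T)

st : ∀ {n} → Fin n → ℕ
st u = suc (toℕ u)

record InD (n m σ : ℕ) (T : Table n σ) : Set where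
  field
    targets   : ∀ u a v → entry T u a ≡ just v → 1 ≤ v × v ≤ n
    size      : numTrans T ≡ m
    effective : ∀ (a : Fin σ) → Σ (Fin n) λ u → Σ ℕ λ v → entry T u a ≡ just v
    incoming⇒ : ∀ v → 1 ≤ v → v ≤ n →
                  (Σ (Fin n) λ u → Σ (Fin σ) λ a → entry T u a ≡ just v) → 1 < v
    incoming⇐ : ∀ v → 1 < v → v ≤ n →
                  Σ (Fin n) λ u → Σ (Fin σ) λ a → entry T u a ≡ just v
    wheeler₁  : ∀ u v (a a' : Fin σ) u' v' →
                  entry T u a ≡ just u' → entry T v a' ≡ just v' →
                  toℕ a < toℕ a' → u' < v'
    wheeler₂  : ∀ (u v : Fin n) a u' v' →
                  entry T u a ≡ just u' → entry T v a ≡ just v' →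
                  u' ≢ v' → st u < st v → u' < v'

-- Step (2): the mask 1 #^{c₁-1} 1 #^{c₂-1} … with the #'s replaced,
-- left to right, by the bits of b.
fillMask : List ℕ → List Bool → List Bool
fillMask []       b = []
fillMask (c ∷ cs) b = (true ∷ take (c ∸ 1) b) ++ fillMask cs (drop (c ∸ 1) b)

colCounts : List (List Bool) → List ℕ
colCounts []         = []
colCounts (c ∷ cols) = ones c ∷ colCounts cols

-- State: current u, current v, remaining suffix of I (I_i is its head).
-- Returns emitted transitions (u , j , v), the final v and remaining I.
-- (The case "I exhausted" never occurs on valid inputs; it reads I_i = 0.)
innerLoop : (u j : ℕ) → List Bool → (v : ℕ) → List Bool →
            List (ℕ × ℕ × ℕ) × ℕ × List Bool
innerLoop u j []            v I = [] , v , I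
innerLoop u j (false ∷ col) v I = innerLoop (suc u) j col v I
innerLoop u j (true ∷ col)  v [] with innerLoop (suc u) j col v []
... | ts , v'' , I'' = (u , j , v) ∷ ts , v'' , I''
innerLoop u j (true ∷ col)  v (x ∷ I)
  with (if x then suc v else v)
... | v' with innerLoop (suc u) j col v' I
...   | ts , v'' , I'' = (u , j , v') ∷ ts , v'' , I''

outerLoop : (j : ℕ) → List (List Bool) → (v : ℕ) → List Bool → List (ℕ × ℕ × ℕ)
outerLoop j []         v I = []
outerLoop j (c ∷ cols) v I with innerLoop 1 j c v I
... | ts , v' , I' = ts ++ outerLoop (suc j) cols v' I'

find : ℕ → ℕ → List (ℕ × ℕ × ℕ) → Maybe ℕ
find u a []                 = nothing
find u a ((u' , a' , v) ∷ ts) =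
  if (u ≡ᵇ u') ∧ (a ≡ᵇ a') then just v else find u a ts

-- The output automaton ([n],[σ],δ) of the procedure on the random
-- choices O (given as the flattened string w) and b.
output : (n σ : ℕ) → List Bool → List Bool → Table n σ
output n σ w b =
  let cols = columns n σ w
      I    = fillMask (colCounts cols) b
      ts   = outerLoop 1 cols 1 I
  in tabulate λ u → tabulate λ a → find (st u) (st a) ts

-- The (accepted) random choices: w a permutation of 1^m 0^{nσ-m} whose
-- column reshape has every column nonempty, and b a permutation of
-- 1^{n-σ-1} 0^{m-n+1}.
record Choice (n m σ : ℕ) : Set where
  constructor choice
  field
    w      : List Bool
    w-len  : length w ≡ n * σ
    w-ones : ones w ≡ m
    w-cols : All (λ c → 1 ≤ ones c) (columns n σ w)
    b      : List Bool
    b-len  : length b ≡ (n ∸ σ ∸ 1) + (m + 1 ∸ n)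
    b-ones : ones b ≡ n ∸ σ ∸ 1

run : ∀ {n m σ} → Choice n m σ → Table n σ
run {n} {m} {σ} c = output n σ (Choice.w c) (Choice.b c)

Fiber : (n m σ : ℕ) → Table n σ → Set
Fiber n m σ T = Σ (Choice n m σ) λ c → run c ≡ T

-- Read letter by letter, the transition table of a Wheeler DFA is a
-- staircase: listed by source state, the targets of the a-transitions are weakly
-- increasing with steps of at most one, the letters occupy consecutive blocks of
-- target states, and since every state but 1 is entered the first a-transition
-- always enters a new state. So the table is determined by the pattern O of its
-- defined entries together with the bits I telling where the target increases;
-- the first bit of each column is forced to be 1 and the remaining ones form b,
-- with n - σ - 1 ones. Conversely every such pair (O , b) is produced by, and
-- recovered from, a Wheeler DFA. Thus the procedure is a bijection from accepted
-- choices onto 𝒟_{n,m,σ}: every fibre over 𝒟_{n,m,σ} is a singleton.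

module Submission where

open import Defs
open import Axiom.UniquenessOfIdentityProofs.WithK using (uip)
open import Data.Bool using (Bool; true; false; _∧_)
open import Data.Bool.Properties using (∧-zeroʳ)
open import Data.Empty using (⊥-elim)
open import Data.Fin using (Fin; toℕ)
import Data.Fin as Fin
open import Data.Fin.Properties using (toℕ-injective)
open import Data.List using (List; []; _∷_; length; take; drop; _++_; map; concat)
import Data.List as List
open import Data.List.Properties
  using (length-++; length-map; length-take; length-drop; length-tabulate; take++drop≡id; tabulate-cong; map-∘)
open import Data.List.Relation.Unary.All using (All; []; _∷_)
import Data.List.Relation.Unary.All as All
open import Data.List.Relation.Unary.All.Properties using (map⁺; map⁻; tabulate⁺; tabulate⁻)
open import Data.Maybe using (Maybe; just; nothing; is-just; _<∣>_)
open import Data.Maybe.Properties using (<∣>-identityʳ; just-injective)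
open import Data.Nat using (ℕ; zero; suc; _+_; _*_; _∸_; _≤_; _<_; _≡ᵇ_; z≤n; s≤s; _⊔_; _≟_; _≤?_)
open import Data.Nat.ListAction using (sum)
open import Data.Nat.Properties
open import Data.Nat.Tactic.RingSolver using (solve-∀)
open import Data.Product using (∃-syntax; _×_; _,_; proj₁; proj₂)
open import Data.Sum using (inj₁; inj₂)
open import Data.Vec using (Vec; lookup; tabulate)
import Data.Vec as Vec
import Data.Vec.Properties as Vec
open import Function using (_∘_)
open import Function.Bundles using (_↔_; mk↔ₛ′)
open import Relation.Binary.PropositionalEquality hiding (J)
open import Relation.Nullary using (Dec; yes; no)

import Algebra.Properties.CommutativeMonoid.Sum +-0-commutativeMonoid as ∑

-- Bit strings

ones-++ : ∀ xs ys → ones (xs ++ ys) ≡ ones xs + ones ys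
ones-++ []           ys = refl
ones-++ (true ∷ xs)  ys = cong suc (ones-++ xs ys)
ones-++ (false ∷ xs) ys = ones-++ xs ys

ones-concat : ∀ xss → ones (concat xss) ≡ sum (map ones xss)
ones-concat []         = refl
ones-concat (xs ∷ xss) = trans (ones-++ xs (concat xss)) (cong (ones xs +_) (ones-concat xss))

module _ {A : Set} where

  take-++ : ∀ (xs ys : List A) → take (length xs) (xs ++ ys) ≡ xs
  take-++ []       ys = refl
  take-++ (x ∷ xs) ys = cong (x ∷_) (take-++ xs ys)

  drop-++ : ∀ (xs ys : List A) → drop (length xs) (xs ++ ys) ≡ ys
  drop-++ []       ys = refl
  drop-++ (x ∷ xs) ys = drop-++ xs ys

  Uniform : ℕ → List (List A) → Set
  Uniform n = All (λ xs → length xs ≡ n)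

  length-concat-uniform : ∀ {n} xss → Uniform n xss → length (concat xss) ≡ n * length xss
  length-concat-uniform {n} []         []         = sym (*-zeroʳ n)
  length-concat-uniform {n} (xs ∷ xss) (p ∷ ps) = begin
    length (xs ++ concat xss)        ≡⟨ length-++ xs ⟩
    length xs + length (concat xss)  ≡⟨ cong₂ _+_ p (length-concat-uniform xss ps) ⟩
    n + n * length xss               ≡⟨ *-suc n (length xss) ⟨
    n * suc (length xss)             ∎
    where open ≡-Reasoning

length-take-drop : ∀ {A : Set} k {r} (xs : List A) → length xs ≡ k + r →
                   length (take k xs) ≡ k × length (drop k xs) ≡ r
length-take-drop k {r} xs eq =
  trans (length-take k xs) (m≤n⇒m⊓n≡m (subst (k ≤_) (sym eq) (m≤m+n k r))) ,
  trans (length-drop k xs) (trans (cong (_∸ k) eq) (m+n∸m≡n k r))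

1+[n∸1]≡n : ∀ {n} → 1 ≤ n → suc (n ∸ 1) ≡ n
1+[n∸1]≡n (s≤s z≤n) = refl

sum-∸1 : ∀ cols → All (λ col → 1 ≤ ones col) cols →
         sum (map (λ col → ones col ∸ 1) cols) + length cols ≡ sum (map ones cols)
sum-∸1 []           []       = refl
sum-∸1 (col ∷ cols) (o ∷ os) = begin
  ones col ∸ 1 + rest + suc (length cols)  ≡⟨ +-suc (ones col ∸ 1 + rest) (length cols) ⟩
  suc (ones col ∸ 1 + rest + length cols)  ≡⟨ cong suc (+-assoc (ones col ∸ 1) rest (length cols)) ⟩
  suc (ones col ∸ 1) + (rest + length cols) ≡⟨ cong₂ _+_ (1+[n∸1]≡n o) (sum-∸1 cols os) ⟩
  ones col + sum (map ones cols)            ∎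
  where
  open ≡-Reasoning
  rest = sum (map (λ col → ones col ∸ 1) cols)

length-columns : ∀ n k w → length (columns n k w) ≡ k
length-columns n zero    w = refl
length-columns n (suc k) w = cong suc (length-columns n k (drop n w))

columns-uniform : ∀ n k w → length w ≡ n * k → Uniform n (columns n k w)
columns-uniform n zero    w eq = []
columns-uniform n (suc k) w eq =
  let length-block , length-rest = length-take-drop n w (trans eq (*-suc n k))
  in length-block ∷ columns-uniform n k (drop n w) length-rest

concat-columns : ∀ n k w → length w ≡ n * k → concat (columns n k w) ≡ w
concat-columns n zero    []      eq = refl
concat-columns n zero    (_ ∷ _) eq with trans eq (*-zeroʳ n)
... | ()
concat-columns n (suc k) w eq =
  trans (cong (take n w ++_) (concat-columns n k (drop n w) (proj₂ (length-take-drop n w (trans eq (*-suc n k))))))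
        (take++drop≡id n w)

columns-concat : ∀ {n} cs → Uniform n cs → columns n (length cs) (concat cs) ≡ cs
columns-concat []       []         = refl
columns-concat (c ∷ cs) (refl ∷ ps) rewrite take-++ c (concat cs) | drop-++ c (concat cs) =
  cong (c ∷_) (columns-concat cs ps)

ones-columns : ∀ n k w → length w ≡ n * k → sum (map ones (columns n k w)) ≡ ones w
ones-columns n k w eq = trans (sym (ones-concat (columns n k w))) (cong ones (concat-columns n k w eq))

-- Columns of transition targets

Column : Set
Column = List (Maybe ℕ)

private variable
  v v' v'' t x y : ℕ
  c : Column
  J B : List Bool
  M : List Column

support : Column → List Bool
support = map is-just

infixl 9 _!_ _!!_
infix 4 _∈ᶜ_

_!_ : Column → ℕ → Maybe ℕ
[]      ! _     = nothing
(t ∷ _) ! zero  = t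
(_ ∷ c) ! suc i = c ! i

_!!_ : List Column → ℕ → Column
[]      !! _     = []
(c ∷ _) !! zero  = c
(_ ∷ M) !! suc a = M !! a

_∈ᶜ_ : ℕ → Column → Set
x ∈ᶜ c = ∃[ i ] c ! i ≡ just x

Monotone : Column → Set
Monotone c = ∀ {i j x y} → i < j → c ! i ≡ just x → c ! j ≡ just y → x ≤ y

∈ᶜ-∷ : ∀ {x z c} → x ∈ᶜ c → x ∈ᶜ z ∷ c
∈ᶜ-∷ (i , e) = suc i , e

∈ᶜ-tail : ∀ {x z c} → x ∈ᶜ z ∷ c → z ≢ just x → x ∈ᶜ c
∈ᶜ-tail (zero  , e) z≢x = ⊥-elim (z≢x e)
∈ᶜ-tail (suc i , e) _   = i , e

∈ᶜ⇒ones-support : ∀ {x} c → x ∈ᶜ c → 1 ≤ ones (support c)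
∈ᶜ⇒ones-support (nothing ∷ c) (suc i , e) = ∈ᶜ⇒ones-support c (i , e)
∈ᶜ⇒ones-support (just _ ∷ c)  _           = s≤s z≤n

ones-support⇒∈ᶜ : ∀ c → 1 ≤ ones (support c) → ∃[ x ] x ∈ᶜ c
ones-support⇒∈ᶜ (nothing ∷ c) o = let x , p = ones-support⇒∈ᶜ c o in x , ∈ᶜ-∷ p
ones-support⇒∈ᶜ (just x ∷ c)  _ = x , zero , refl

Monotone-tail : ∀ {z c} → Monotone (z ∷ c) → Monotone c
Monotone-tail mono i<j = mono (s≤s i<j)

Monotone-head : ∀ {y c x} → Monotone (just y ∷ c) → x ∈ᶜ c → y ≤ x
Monotone-head mono (_ , e) = mono (s≤s z≤n) refl e

Monotone-skip : ∀ {c} → Monotone c → Monotone (nothing ∷ c)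
Monotone-skip mono {suc i} {suc j} (s≤s i<j) = mono i<j

Monotone-∷ : ∀ {y c} → (∀ {x} → x ∈ᶜ c → y ≤ x) → Monotone c → Monotone (just y ∷ c)
Monotone-∷ head _    {zero}  {suc j} _         refl e = head (j , e)
Monotone-∷ _    mono {suc i} {suc j} (s≤s i<j)      = mono i<j

maxTarget : Column → ℕ
maxTarget []            = 0
maxTarget (nothing ∷ c) = maxTarget c
maxTarget (just x ∷ c)  = x ⊔ maxTarget c

≤-maxTarget : ∀ {x} c → x ∈ᶜ c → x ≤ maxTarget c
≤-maxTarget (nothing ∷ c) (suc i , e)    = ≤-maxTarget c (i , e)
≤-maxTarget (just x ∷ c)  (zero , refl)  = m≤m⊔n x (maxTarget c)
≤-maxTarget (just y ∷ c)  (suc i , e)    = ≤-trans (≤-maxTarget c (i , e)) (m≤n⊔m y (maxTarget c))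

maxTarget-∈ᶜ : ∀ c → 0 < maxTarget c → maxTarget c ∈ᶜ c
maxTarget-∈ᶜ (nothing ∷ c) pos = ∈ᶜ-∷ (maxTarget-∈ᶜ c pos)
maxTarget-∈ᶜ (just y ∷ c)  pos with maxTarget c ≤? y
... | yes my≤y rewrite m≥n⇒m⊔n≡m my≤y = zero , refl
... | no  my≰y rewrite m≤n⇒m⊔n≡n (<⇒≤ (≰⇒> my≰y)) =
  ∈ᶜ-∷ (maxTarget-∈ᶜ c (≤-<-trans z≤n (≰⇒> my≰y)))

-- Staircases and layouts

-- J is the stretch of the string I consumed while the inner loop scans column c,
-- and v, v' are the values of the loop variable v before and after.
data Staircase : ℕ → Column → ℕ → List Bool → Set where
  []   : Staircase v [] v []
  skip : Staircase v c v' J → Staircase v (nothing ∷ c) v' J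
  stay : Staircase v c v' J → Staircase v (just v ∷ c) v' (false ∷ J)
  step : Staircase (suc v) c v' J → Staircase v (just (suc v) ∷ c) v' (true ∷ J)

Staircase-length : Staircase v c v' J → length J ≡ ones (support c)
Staircase-length []       = refl
Staircase-length (skip s) = Staircase-length s
Staircase-length (stay s) = cong suc (Staircase-length s)
Staircase-length (step s) = cong suc (Staircase-length s)

Staircase-final : Staircase v c v' J → v' ≡ v + ones J
Staircase-final {v} []       = sym (+-identityʳ v)
Staircase-final     (skip s) = Staircase-final s
Staircase-final     (stay s) = Staircase-final s
Staircase-final {v} (step s) = trans (Staircase-final s) (sym (+-suc v _))

Staircase-≤ : Staircase v c v' J → v ≤ v'
Staircase-≤ {v} s = subst (v ≤_) (sym (Staircase-final s)) (m≤m+n v _)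

Staircase-bounds : Staircase v c v' J → x ∈ᶜ c → v ≤ x × x ≤ v'
Staircase-bounds (skip s) (suc i , e)   = Staircase-bounds s (i , e)
Staircase-bounds (stay s) (zero , refl) = ≤-refl , Staircase-≤ s
Staircase-bounds (stay s) (suc i , e)   = Staircase-bounds s (i , e)
Staircase-bounds (step s) (zero , refl) = n≤1+n _ , Staircase-≤ s
Staircase-bounds (step s) (suc i , e)   =
  let v<x , x≤v' = Staircase-bounds s (i , e) in <⇒≤ v<x , x≤v'

Staircase-fresh : Staircase v c v' (true ∷ J) → x ∈ᶜ c → v < x
Staircase-fresh (skip s) (suc i , e)   = Staircase-fresh s (i , e)
Staircase-fresh (step s) (zero , refl) = ≤-refl
Staircase-fresh (step s) (suc i , e)   = proj₁ (Staircase-bounds s (i , e))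

Staircase-monotone : Staircase v c v' J → Monotone c
Staircase-monotone []       _ ()
Staircase-monotone (skip s) = Monotone-skip (Staircase-monotone s)
Staircase-monotone (stay s) = Monotone-∷ (proj₁ ∘ Staircase-bounds s) (Staircase-monotone s)
Staircase-monotone (step s) = Monotone-∷ (proj₁ ∘ Staircase-bounds s) (Staircase-monotone s)

Staircase-covers : Staircase v c v' J → v < x → x ≤ v' → x ∈ᶜ c
Staircase-covers []       v<x x≤v  = ⊥-elim (<⇒≱ v<x x≤v)
Staircase-covers (skip s) v<x x≤v' = ∈ᶜ-∷ (Staircase-covers s v<x x≤v')
Staircase-covers (stay s) v<x x≤v' = ∈ᶜ-∷ (Staircase-covers s v<x x≤v')
Staircase-covers {v} {x = x} (step s) v<x x≤v' with x ≟ suc v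
... | yes refl = zero , refl
... | no  x≢1+v = ∈ᶜ-∷ (Staircase-covers s (≤∧≢⇒< v<x (x≢1+v ∘ sym)) x≤v')

Staircase-deterministic : ∀ {v₁ v₂ J₁ J₂} → Staircase v c v₁ J₁ → Staircase v c v₂ J₂ →
                          J₁ ≡ J₂ × v₁ ≡ v₂
Staircase-deterministic []       []       = refl , refl
Staircase-deterministic (skip s) (skip s') = Staircase-deterministic s s'
Staircase-deterministic (stay s) (stay s') with Staircase-deterministic s s'
... | refl , v₁≡v₂ = refl , v₁≡v₂
Staircase-deterministic (step s) (step s') with Staircase-deterministic s s'
... | refl , v₁≡v₂ = refl , v₁≡v₂

staircase : ∀ c → v ≤ t → (∀ {x} → x ∈ᶜ c → v ≤ x × x ≤ t) → Monotone c →
            (∀ {x} → v < x → x ≤ t → x ∈ᶜ c) → ∃[ J ] Staircase v c t J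
staircase [] v≤t _ _ covers with m≤n⇒m<n∨m≡n v≤t
... | inj₁ v<t with () ← proj₂ (covers v<t ≤-refl)
... | inj₂ refl = [] , []
staircase (nothing ∷ c) v≤t bounds mono covers =
  let J , s = staircase c v≤t (bounds ∘ ∈ᶜ-∷) (Monotone-tail mono)
                (λ v<x x≤t → ∈ᶜ-tail (covers v<x x≤t) λ ())
  in J , skip s
staircase {v} {t} (just y ∷ c) _ bounds mono covers = extend (y ≟ v) (y ≟ suc v)
  where
  v≤y : v ≤ y
  v≤y = proj₁ (bounds (zero , refl))
  y≤t : y ≤ t
  y≤t = proj₂ (bounds (zero , refl))

  rest : ∃[ J ] Staircase y c t J
  rest = staircase c y≤t (λ p → Monotone-head mono p , proj₂ (bounds (∈ᶜ-∷ p)))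
           (Monotone-tail mono)
           (λ y<x x≤t → ∈ᶜ-tail (covers (≤-<-trans v≤y y<x) x≤t)
                                (λ e → <-irrefl (just-injective e) y<x))

  extend : Dec (y ≡ v) → Dec (y ≡ suc v) → ∃[ J ] Staircase v (just y ∷ c) t J
  extend (yes refl) _          = let J , s = rest in false ∷ J , stay s
  extend (no _)     (yes refl) = let J , s = rest in true ∷ J , step s
  extend (no y≢v)   (no y≢1+v) = ⊥-elim (<⇒≱ 1+v<y (Monotone-head mono 1+v∈c))
    where
    1+v<y : suc v < y
    1+v<y = ≤∧≢⇒< (≤∧≢⇒< v≤y (y≢v ∘ sym)) (y≢1+v ∘ sym)
    -- the gap state suc v must occur in the column, but not above y
    1+v∈c : suc v ∈ᶜ c
    1+v∈c = ∈ᶜ-tail (covers ≤-refl (≤-trans (<⇒≤ 1+v<y) y≤t)) (y≢1+v ∘ just-injective)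

starts-with-step : Staircase v c t J → v < t → (∀ {x} → x ∈ᶜ c → v < x) → ∃[ J' ] J ≡ true ∷ J'
starts-with-step []       v<v _     = ⊥-elim (<-irrefl refl v<v)
starts-with-step (skip s) v<t above = starts-with-step s v<t (above ∘ ∈ᶜ-∷)
starts-with-step (stay s) _   above = ⊥-elim (<-irrefl refl (above (zero , refl)))
starts-with-step (step s) _   _     = _ , refl

fresh-staircase : ∀ c → v < t → (∀ {x} → x ∈ᶜ c → v < x × x ≤ t) → Monotone c →
                  (∀ {x} → v < x → x ≤ t → x ∈ᶜ c) → ∃[ J ] Staircase v c t (true ∷ J)
fresh-staircase c v<t bounds mono covers
  with J , s ← staircase c (<⇒≤ v<t) (λ p → let v<x , x≤t = bounds p in <⇒≤ v<x , x≤t) mono covers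
  with J' , refl ← starts-with-step s v<t (proj₁ ∘ bounds)
  = J' , s

-- Each column starts with a forced step: this is the leading 1 of its block in
-- the mask, so only the bits J of the #-positions are recorded.
data Layout : ℕ → List Column → ℕ → List Bool → Set where
  []  : Layout v [] v []
  _∷_ : Staircase v c v' (true ∷ J) → Layout v' M v'' B → Layout v (c ∷ M) v'' (J ++ B)

Layout-length : Layout v M v'' B → length B + length M ≡ sum (map (ones ∘ support) M)
Layout-length [] = refl
Layout-length (_∷_ {J = J} {M = M} {B = B} s l) = begin
  length (J ++ B) + suc (length M)       ≡⟨ cong (_+ suc (length M)) (length-++ J) ⟩
  length J + length B + suc (length M)   ≡⟨ regroup (length J) (length B) (length M) ⟩
  suc (length J) + (length B + length M) ≡⟨ cong₂ _+_ (Staircase-length s) (Layout-length l) ⟩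
  _                                      ∎
  where
  open ≡-Reasoning
  regroup : ∀ a b c → a + b + suc c ≡ suc a + (b + c)
  regroup = solve-∀

Layout-final : Layout v M v'' B → v'' ≡ v + length M + ones B
Layout-final {v} [] = sym (trans (+-identityʳ (v + 0)) (+-identityʳ v))
Layout-final {v} (_∷_ {J = J} {M = M} {B = B} s l) = begin
  _                                    ≡⟨ Layout-final l ⟩
  _ + length M + ones B                ≡⟨ cong (λ v' → v' + length M + ones B) (Staircase-final s) ⟩
  v + suc (ones J) + length M + ones B ≡⟨ cong (λ k → k + length M + ones B) (+-suc v (ones J)) ⟩
  suc v + ones J + length M + ones B   ≡⟨ regroup v (ones J) (length M) (ones B) ⟩
  v + suc (length M) + (ones J + ones B) ≡⟨ cong (v + suc (length M) +_) (ones-++ J B) ⟨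
  v + suc (length M) + ones (J ++ B)   ∎
  where
  open ≡-Reasoning
  regroup : ∀ a b c d → suc a + b + c + d ≡ a + suc c + (b + d)
  regroup = solve-∀

Layout-≤ : Layout v M v'' B → v ≤ v''
Layout-≤ []      = ≤-refl
Layout-≤ (s ∷ l) = ≤-trans (Staircase-≤ s) (Layout-≤ l)

Layout-deterministic : ∀ {v₁ v₂ B₁ B₂} → Layout v M v₁ B₁ → Layout v M v₂ B₂ →
                       B₁ ≡ B₂ × v₁ ≡ v₂
Layout-deterministic []      []        = refl , refl
Layout-deterministic (s ∷ l) (s' ∷ l') with Staircase-deterministic s s'
... | refl , refl with Layout-deterministic l l'
... | refl , v₁≡v₂ = refl , v₁≡v₂

-- Column-wise form of the Wheeler axioms (monotone is (ii), increasing is (i)),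
-- together with "every state in (v , N] is entered".
record Wheeler (v N : ℕ) (M : List Column) : Set where
  field
    bounds     : ∀ a {x} → x ∈ᶜ M !! a → v < x × x ≤ N
    monotone   : ∀ a → Monotone (M !! a)
    increasing : ∀ {a a' x y} → a < a' → x ∈ᶜ M !! a → y ∈ᶜ M !! a' → x < y
    reached    : ∀ {x} → v < x → x ≤ N → ∃[ a ] x ∈ᶜ M !! a

Layout-bounds : Layout v M v'' B → ∀ a {x} → x ∈ᶜ M !! a → v < x × x ≤ v''
Layout-bounds (s ∷ l) zero    p = Staircase-fresh s p , ≤-trans (proj₂ (Staircase-bounds s p)) (Layout-≤ l)
Layout-bounds (s ∷ l) (suc a) p =
  let v'<x , x≤v'' = Layout-bounds l a p in ≤-<-trans (Staircase-≤ s) v'<x , x≤v''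

Layout-monotone : Layout v M v'' B → ∀ a → Monotone (M !! a)
Layout-monotone []      _       _ ()
Layout-monotone (s ∷ _) zero    = Staircase-monotone s
Layout-monotone (_ ∷ l) (suc a) = Layout-monotone l a

Layout-increasing : Layout v M v'' B → ∀ {a a'} → a < a' → x ∈ᶜ M !! a → y ∈ᶜ M !! a' → x < y
Layout-increasing (s ∷ l) {zero}  {suc a'} _         p q =
  ≤-<-trans (proj₂ (Staircase-bounds s p)) (proj₁ (Layout-bounds l a' q))
Layout-increasing (_ ∷ l) {suc a} {suc a'} (s≤s a<a') p q = Layout-increasing l a<a' p q

Layout-reached : Layout v M v'' B → v < x → x ≤ v'' → ∃[ a ] x ∈ᶜ M !! a
Layout-reached []                 v<x x≤v   = ⊥-elim (<⇒≱ v<x x≤v)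
Layout-reached {x = x} (_∷_ {v' = v'} s l) v<x x≤v'' with x ≤? v'
... | yes x≤v' = zero , Staircase-covers s v<x x≤v'
... | no  x≰v' = let a , p = Layout-reached l (≰⇒> x≰v') x≤v'' in suc a , p

Layout⇒Wheeler : Layout v M v'' B → Wheeler v v'' M
Layout⇒Wheeler l = record
  { bounds     = Layout-bounds l
  ; monotone   = Layout-monotone l
  ; increasing = Layout-increasing l
  ; reached    = Layout-reached l
  }

Wheeler⇒Layout : ∀ {N} M → v ≤ N → Wheeler v N M → All (λ c → ∃[ x ] x ∈ᶜ c) M →
                 ∃[ B ] Layout v M N B
Wheeler⇒Layout [] v≤N W [] with m≤n⇒m<n∨m≡n v≤N
... | inj₁ v<N with _ , _ , () ← Wheeler.reached W v<N ≤-refl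
... | inj₂ refl = [] , []
Wheeler⇒Layout {v} {N} (c ∷ M) _ W ((x , x∈c) ∷ nonempty) =
  let J , s = fresh-staircase c v<top column-bounds (monotone 0) column-covers
      B , l = Wheeler⇒Layout M top≤N rest nonempty
  in J ++ B , s ∷ l
  where
  open Wheeler W
  -- the column ends in its largest target, and the next one starts above it
  top : ℕ
  top = maxTarget c
  top∈c : top ∈ᶜ c
  top∈c = maxTarget-∈ᶜ c (<-≤-trans (≤-<-trans z≤n (proj₁ (bounds 0 x∈c))) (≤-maxTarget c x∈c))
  v<top : v < top
  v<top = proj₁ (bounds 0 top∈c)
  top≤N : top ≤ N
  top≤N = proj₂ (bounds 0 top∈c)

  column-bounds : ∀ {y} → y ∈ᶜ c → v < y × y ≤ top
  column-bounds p = proj₁ (bounds 0 p) , ≤-maxTarget c p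

  column-covers : ∀ {y} → v < y → y ≤ top → y ∈ᶜ c
  column-covers v<y y≤top with reached v<y (≤-trans y≤top top≤N)
  ... | zero  , p = p
  ... | suc _ , p = ⊥-elim (<⇒≱ (increasing (s≤s z≤n) top∈c p) y≤top)

  rest : Wheeler top N M
  rest = record
    { bounds     = λ a p → increasing (s≤s z≤n) top∈c p , proj₂ (bounds (suc a) p)
    ; monotone   = monotone ∘ suc
    ; increasing = increasing ∘ s≤s
    ; reached    = λ top<y y≤N → reached-rest (reached (<-trans v<top top<y) y≤N) top<y
    }
    where
    reached-rest : ∀ {y} → ∃[ a ] y ∈ᶜ (c ∷ M) !! a → top < y → ∃[ a ] y ∈ᶜ M !! a
    reached-rest (zero  , p) top<y = ⊥-elim (<⇒≱ top<y (≤-maxTarget c p))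
    reached-rest (suc a , p) _     = a , p

staircase-with-support : ∀ v col J → length J ≡ ones col →
                         ∃[ c ] ∃[ v' ] Staircase v c v' J × support c ≡ col
staircase-with-support v [] [] _ = [] , v , [] , refl
staircase-with-support v (false ∷ col) J eq
  with c , v' , s , refl ← staircase-with-support v col J eq
  = nothing ∷ c , v' , skip s , refl
staircase-with-support v (true ∷ col) (false ∷ J) eq
  with c , v' , s , refl ← staircase-with-support v col J (suc-injective eq)
  = just v ∷ c , v' , stay s , refl
staircase-with-support v (true ∷ col) (true ∷ J) eq
  with c , v' , s , refl ← staircase-with-support (suc v) col J (suc-injective eq)
  = just (suc v) ∷ c , v' , step s , refl

layout-with-support : ∀ v cols B → All (λ col → 1 ≤ ones col) cols →
                      length B ≡ sum (map (λ col → ones col ∸ 1) cols) →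
                      ∃[ M ] ∃[ v'' ] Layout v M v'' B × map support M ≡ cols
layout-with-support v []           []      []       _  = [] , v , [] , refl
layout-with-support v (col ∷ cols) B       (o ∷ os) eq
  with take-length , drop-length ← length-take-drop (ones col ∸ 1) B eq
  with c , v' , s , refl ← staircase-with-support v col (true ∷ take (ones col ∸ 1) B)
                             (trans (cong suc take-length) (1+[n∸1]≡n o))
  with M , v'' , l , refl ← layout-with-support v' cols (drop (ones col ∸ 1) B) os drop-length
  = c ∷ M , v'' , subst (Layout v (c ∷ M) v'') (take++drop≡id (ones col ∸ 1) B) (s ∷ l) , refl

-- The loops of the procedure

Edge : Set
Edge = ℕ × ℕ × ℕ

edges : ℕ → ℕ → Column → List Edge
edges u j []            = []
edges u j (nothing ∷ c) = edges (suc u) j c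
edges u j (just v ∷ c)  = (u , j , v) ∷ edges (suc u) j c

layoutEdges : ℕ → List Column → List Edge
layoutEdges j []      = []
layoutEdges j (c ∷ M) = edges 1 j c ++ layoutEdges (suc j) M

innerLoop-Staircase : ∀ u j R → Staircase v c v' J →
                      innerLoop u j (support c) v (J ++ R) ≡ (edges u j c , v' , R)
innerLoop-Staircase u j R []       = refl
innerLoop-Staircase u j R (skip s) = innerLoop-Staircase (suc u) j R s
innerLoop-Staircase u j R (stay s) rewrite innerLoop-Staircase (suc u) j R s = refl
innerLoop-Staircase u j R (step s) rewrite innerLoop-Staircase (suc u) j R s = refl

outerLoop-Layout : ∀ j → Layout v M v'' B →
                   outerLoop j (map support M) v (fillMask (colCounts (map support M)) B) ≡ layoutEdges j M
outerLoop-Layout j [] = refl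
outerLoop-Layout j (_∷_ {c = c} {J = J} {M = M} {B = B} s l)
  rewrite sym (Staircase-length s) | take-++ J B | drop-++ J B
        | innerLoop-Staircase 1 j (fillMask (colCounts (map support M)) B) s
        | outerLoop-Layout (suc j) l
  = refl

≡ᵇ-refl : ∀ n → (n ≡ᵇ n) ≡ true
≡ᵇ-refl zero    = refl
≡ᵇ-refl (suc n) = ≡ᵇ-refl n

≢⇒≡ᵇ-false : ∀ {m n} → m ≢ n → (m ≡ᵇ n) ≡ false
≢⇒≡ᵇ-false {zero}  {zero}  m≢n = ⊥-elim (m≢n refl)
≢⇒≡ᵇ-false {zero}  {suc n} _   = refl
≢⇒≡ᵇ-false {suc m} {zero}  _   = refl
≢⇒≡ᵇ-false {suc m} {suc n} m≢n = ≢⇒≡ᵇ-false (m≢n ∘ cong suc)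

module _ {u a : ℕ} where

  find-here : ∀ {v} ts → find u a ((u , a , v) ∷ ts) ≡ just v
  find-here _ rewrite ≡ᵇ-refl u | ≡ᵇ-refl a = refl

  find-other-row : ∀ {u' a' v} ts → u ≢ u' → find u a ((u' , a' , v) ∷ ts) ≡ find u a ts
  find-other-row _ u≢u' rewrite ≢⇒≡ᵇ-false u≢u' = refl

  find-other-column : ∀ {u' a' v} ts → a ≢ a' → find u a ((u' , a' , v) ∷ ts) ≡ find u a ts
  find-other-column {u'} _ a≢a' rewrite ≢⇒≡ᵇ-false a≢a' | ∧-zeroʳ (u ≡ᵇ u') = refl

  find-++ : ∀ ts ts' → find u a (ts ++ ts') ≡ (find u a ts <∣> find u a ts')
  find-++ []                  _   = refl
  find-++ ((u' , a' , v) ∷ ts) ts' with (u ≡ᵇ u') ∧ (a ≡ᵇ a')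
  ... | true  = refl
  ... | false = find-++ ts ts'

find-edges-above : ∀ {u a u₀ j} c → u < u₀ → find u a (edges u₀ j c) ≡ nothing
find-edges-above []            _    = refl
find-edges-above (nothing ∷ c) u<u₀ = find-edges-above c (m<n⇒m<1+n u<u₀)
find-edges-above (just _ ∷ c)  u<u₀ =
  trans (find-other-row (edges (suc _) _ c) (<⇒≢ u<u₀)) (find-edges-above c (m<n⇒m<1+n u<u₀))

find-edges-other-column : ∀ {u a u₀ j} c → a ≢ j → find u a (edges u₀ j c) ≡ nothing
find-edges-other-column []            _   = refl
find-edges-other-column (nothing ∷ c) a≢j = find-edges-other-column c a≢j
find-edges-other-column (just _ ∷ c)  a≢j =
  trans (find-other-column (edges (suc _) _ c) a≢j) (find-edges-other-column c a≢j)

find-edges : ∀ u₀ i j c → find (u₀ + i) j (edges u₀ j c) ≡ c ! i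
find-edges u₀ i       j []            = refl
find-edges u₀ zero    j (nothing ∷ c) = find-edges-above c (s≤s (≤-reflexive (+-identityʳ u₀)))
find-edges u₀ (suc i) j (nothing ∷ c) rewrite +-suc u₀ i = find-edges (suc u₀) i j c
find-edges u₀ zero    j (just _ ∷ c)  rewrite +-identityʳ u₀ = find-here (edges (suc u₀) j c)
find-edges u₀ (suc i) j (just _ ∷ c)  rewrite +-suc u₀ i =
  trans (find-other-row (edges (suc u₀) j c) (m≢1+m+n u₀ ∘ sym)) (find-edges (suc u₀) i j c)

find-layoutEdges-before : ∀ {u a j} M → a < j → find u a (layoutEdges j M) ≡ nothing
find-layoutEdges-before []      _   = refl
find-layoutEdges-before (c ∷ M) a<j =
  trans (find-++ (edges 1 _ c) _)
        (cong₂ _<∣>_ (find-edges-other-column c (<⇒≢ a<j)) (find-layoutEdges-before M (m<n⇒m<1+n a<j)))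

find-layoutEdges : ∀ i j a M → find (suc i) (j + a) (layoutEdges j M) ≡ M !! a ! i
find-layoutEdges i j a       []      = refl
find-layoutEdges i j zero    (c ∷ M) rewrite +-identityʳ j = begin
  find (suc i) j (edges 1 j c ++ layoutEdges (suc j) M)               ≡⟨ find-++ (edges 1 j c) _ ⟩
  find (suc i) j (edges 1 j c) <∣> find (suc i) j (layoutEdges (suc j) M)
    ≡⟨ cong₂ _<∣>_ (find-edges 1 i j c) (find-layoutEdges-before M (n<1+n j)) ⟩
  c ! i <∣> nothing                                                   ≡⟨ <∣>-identityʳ (c ! i) ⟩
  c ! i                                                               ∎
  where open ≡-Reasoning
find-layoutEdges i j (suc a) (c ∷ M) rewrite +-suc j a =
  trans (find-++ (edges 1 j c) _)
        (trans (cong (_<∣> _) (find-edges-other-column c (m≢1+m+n j ∘ sym)))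
               (find-layoutEdges i (suc j) a M))

-- Tables and their columns

module _ {n σ : ℕ} where

  entry-tabulate : ∀ (f : Fin n → Fin σ → Maybe ℕ) u a → entry (tabulate λ u → tabulate (f u)) u a ≡ f u a
  entry-tabulate f u a = trans (cong (λ row → lookup row a) (Vec.lookup∘tabulate _ u)) (Vec.lookup∘tabulate _ a)

  table-ext : ∀ {T T' : Table n σ} → (∀ u a → entry T u a ≡ entry T' u a) → T ≡ T'
  table-ext {T} {T'} same = begin
    T                                       ≡⟨ Vec.tabulate∘lookup T ⟨
    tabulate (lookup T)                     ≡⟨ Vec.tabulate-cong (Vec.tabulate∘lookup ∘ lookup T) ⟨
    tabulate (λ u → tabulate (entry T u))   ≡⟨ Vec.tabulate-cong (λ u → Vec.tabulate-cong (same u)) ⟩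
    tabulate (λ u → tabulate (entry T' u))  ≡⟨ Vec.tabulate-cong (Vec.tabulate∘lookup ∘ lookup T') ⟩
    tabulate (lookup T')                    ≡⟨ Vec.tabulate∘lookup T' ⟩
    T'                                      ∎
    where open ≡-Reasoning

tabulate-! : ∀ {k} (f : Fin k → Maybe ℕ) i → List.tabulate f ! toℕ i ≡ f i
tabulate-! f Fin.zero    = refl
tabulate-! f (Fin.suc i) = tabulate-! (f ∘ Fin.suc) i

tabulate-!! : ∀ {k} (f : Fin k → Column) a → List.tabulate f !! toℕ a ≡ f a
tabulate-!! f Fin.zero    = refl
tabulate-!! f (Fin.suc a) = tabulate-!! (f ∘ Fin.suc) a

tabulate-!⁻¹ : ∀ {k} (f : Fin k → Maybe ℕ) i → List.tabulate f ! i ≡ just x →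
               ∃[ i' ] toℕ i' ≡ i × f i' ≡ just x
tabulate-!⁻¹ {k = suc k} f zero    e = Fin.zero , refl , e
tabulate-!⁻¹ {k = suc k} f (suc i) e =
  let i' , p , e' = tabulate-!⁻¹ (f ∘ Fin.suc) i e in Fin.suc i' , cong suc p , e'

tabulate-!!⁻¹ : ∀ {k} (f : Fin k → Column) a i → List.tabulate f !! a ! i ≡ just x →
                ∃[ a' ] toℕ a' ≡ a × f a' ! i ≡ just x
tabulate-!!⁻¹ {k = suc k} f zero    i e = Fin.zero , refl , e
tabulate-!!⁻¹ {k = suc k} f (suc a) i e =
  let a' , p , e' = tabulate-!!⁻¹ (f ∘ Fin.suc) a i e in Fin.suc a' , cong suc p , e'

tabulate-!-self : ∀ c → List.tabulate (λ (i : Fin (length c)) → c ! toℕ i) ≡ c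
tabulate-!-self []      = refl
tabulate-!-self (t ∷ c) = cong (t ∷_) (tabulate-!-self c)

module _ {n σ : ℕ} where

  column : Table n σ → Fin σ → Column
  column T a = List.tabulate (λ u → entry T u a)

  columnsOf : Table n σ → List Column
  columnsOf T = List.tabulate (column T)

  columnsOf-! : ∀ T u a → columnsOf T !! toℕ a ! toℕ u ≡ entry T u a
  columnsOf-! T u a rewrite tabulate-!! (column T) a = tabulate-! (λ u → entry T u a) u

  columnsOf-!⁻¹ : ∀ T a i → columnsOf T !! a ! i ≡ just x →
                  ∃[ a' ] ∃[ u ] toℕ a' ≡ a × toℕ u ≡ i × entry T u a' ≡ just x
  columnsOf-!⁻¹ T a i e =
    let a' , p , e' = tabulate-!!⁻¹ (column T) a i e
        u  , q , e″ = tabulate-!⁻¹ (λ u → entry T u a') i e'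
    in a' , u , p , q , e″

  columnsOf-unique : ∀ T M → length M ≡ σ → Uniform n M →
                     (∀ u a → entry T u a ≡ M !! toℕ a ! toℕ u) → columnsOf T ≡ M
  columnsOf-unique T M refl uniform same = begin
    List.tabulate (λ a → List.tabulate (λ u → entry T u a))
      ≡⟨ tabulate-cong (λ a → tabulate-cong (λ u → same u a)) ⟩
    List.tabulate (λ a → List.tabulate (λ u → M !! toℕ a ! toℕ u))
      ≡⟨ tabulate-columns M uniform ⟩
    M ∎
    where
    open ≡-Reasoning
    tabulate-columns : ∀ M → Uniform n M →
      List.tabulate (λ (a : Fin (length M)) → List.tabulate (λ (u : Fin n) → M !! toℕ a ! toℕ u)) ≡ M
    tabulate-columns []      []          = refl
    tabulate-columns (c ∷ M) (refl ∷ ps) = cong₂ _∷_ (tabulate-!-self c) (tabulate-columns M ps)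

effective⇒nonempty : ∀ {n σ} (T : Table n σ) → (∀ a → ∃[ u ] ∃[ x ] entry T u a ≡ just x) →
                     All (λ c → ∃[ x ] x ∈ᶜ c) (columnsOf T)
effective⇒nonempty T effective =
  tabulate⁺ λ a → let u , x , e = effective a in x , toℕ u , trans (tabulate-! _ u) e

sumV-map : ∀ {A : Set} {k} (g : A → ℕ) (xs : Vec A k) → sumV (Vec.map g xs) ≡ ∑.sum (g ∘ lookup xs)
sumV-map g Vec.[]         = refl
sumV-map g (x Vec.∷ xs) = cong (g x +_) (sumV-map g xs)

sum-map-tabulate : ∀ {A : Set} {k} (g : A → ℕ) (f : Fin k → A) →
                   sum (map g (List.tabulate f)) ≡ ∑.sum (g ∘ f)
sum-map-tabulate {k = zero}  g f = refl
sum-map-tabulate {k = suc k} g f = cong (g (f Fin.zero) +_) (sum-map-tabulate g (f ∘ Fin.suc))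

ones-support-tabulate : ∀ {k} (f : Fin k → Maybe ℕ) → ones (support (List.tabulate f)) ≡ ∑.sum (defined ∘ f)
ones-support-tabulate {zero}  f = refl
ones-support-tabulate {suc k} f with f Fin.zero
... | just _  = cong suc (ones-support-tabulate (f ∘ Fin.suc))
... | nothing = ones-support-tabulate (f ∘ Fin.suc)

numTrans-columnsOf : ∀ {n σ} (T : Table n σ) → numTrans T ≡ sum (map (ones ∘ support) (columnsOf T))
numTrans-columnsOf T = begin
  numTrans T
    ≡⟨ sumV-map (sumV ∘ Vec.map defined) T ⟩
  ∑.sum (λ u → sumV (Vec.map defined (lookup T u)))
    ≡⟨ ∑.sum-cong-≗ (λ u → sumV-map defined (lookup T u)) ⟩
  ∑.sum (λ u → ∑.sum (λ a → defined (entry T u a)))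
    ≡⟨ ∑.∑-comm (λ u a → defined (entry T u a)) ⟩
  ∑.sum (λ a → ∑.sum (λ u → defined (entry T u a)))
    ≡⟨ ∑.sum-cong-≗ (λ a → ones-support-tabulate (λ u → entry T u a)) ⟨
  ∑.sum (ones ∘ support ∘ column T)
    ≡⟨ sum-map-tabulate (ones ∘ support) (column T) ⟨
  sum (map (ones ∘ support) (columnsOf T))
    ∎
  where open ≡-Reasoning

module _ {n σ : ℕ} (T : Table n σ) where

  patternOf : List Bool
  patternOf = concat (map support (columnsOf T))

  private
    length-supports : length (map support (columnsOf T)) ≡ σ
    length-supports = trans (length-map support (columnsOf T)) (length-tabulate (column T))

    uniform-supports : Uniform n (map support (columnsOf T))
    uniform-supports = map⁺ (tabulate⁺ λ a → trans (length-map is-just (column T a)) (length-tabulate _))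

  length-patternOf : length patternOf ≡ n * σ
  length-patternOf = trans (length-concat-uniform _ uniform-supports) (cong (n *_) length-supports)

  columns-patternOf : columns n σ patternOf ≡ map support (columnsOf T)
  columns-patternOf = subst (λ k → columns n k patternOf ≡ map support (columnsOf T)) length-supports
                            (columns-concat _ uniform-supports)

  ones-patternOf : ones patternOf ≡ numTrans T
  ones-patternOf = begin
    ones patternOf                              ≡⟨ ones-concat (map support (columnsOf T)) ⟩
    sum (map ones (map support (columnsOf T)))  ≡⟨ cong sum (map-∘ (columnsOf T)) ⟨
    sum (map (ones ∘ support) (columnsOf T))    ≡⟨ numTrans-columnsOf T ⟨
    numTrans T                                  ∎
    where open ≡-Reasoning

output-entry : ∀ {n σ w b} → Layout 1 M v b → map support M ≡ columns n σ w →
               ∀ u a → entry (output n σ w b) u a ≡ M !! toℕ a ! toℕ u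
output-entry {M = M} {n = n} {σ} {w} {b} l support-M u a = begin
  entry (output n σ w b) u a
    ≡⟨ entry-tabulate (λ u a → find (st u) (st a) (edgesOf (columns n σ w))) u a ⟩
  find (st u) (st a) (edgesOf (columns n σ w))
    ≡⟨ cong (find (st u) (st a) ∘ edgesOf) support-M ⟨
  find (st u) (st a) (edgesOf (map support M))
    ≡⟨ cong (find (st u) (st a)) (outerLoop-Layout 1 l) ⟩
  find (st u) (st a) (layoutEdges 1 M)
    ≡⟨ find-layoutEdges (toℕ u) 1 (toℕ a) M ⟩
  M !! toℕ a ! toℕ u
    ∎
  where
  open ≡-Reasoning
  edgesOf : List (List Bool) → List Edge
  edgesOf cols = outerLoop 1 cols 1 (fillMask (colCounts cols) b)

shape-from-support : ∀ {n k w} M → map support M ≡ columns n k w → length w ≡ n * k →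
                     length M ≡ k × Uniform n M
shape-from-support {n} {k} {w} M support-M w-len =
  trans (sym (length-map support M)) (trans (cong length support-M) (length-columns n k w)) ,
  All.map (λ {c} e → trans (sym (length-map is-just c)) e)
          (map⁻ (subst (Uniform n) (sym support-M) (columns-uniform n k w w-len)))

columnsOf-output : ∀ {n σ w b} → length w ≡ n * σ → Layout 1 M v b → map support M ≡ columns n σ w →
                   columnsOf (output n σ w b) ≡ M
columnsOf-output {M = M} w-len l support-M =
  let length-M , uniform-M = shape-from-support M support-M w-len
  in columnsOf-unique (output _ _ _ _) M length-M uniform-M (output-entry l support-M)

module _ {n m σ : ℕ} {T : Table n σ} where

  ∈-columnsOf : ∀ {u a} → entry T u a ≡ just x → x ∈ᶜ columnsOf T !! toℕ a
  ∈-columnsOf {u = u} {a} e = toℕ u , trans (columnsOf-! T u a) e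

  InD⇒Wheeler : InD n m σ T → Wheeler 1 n (columnsOf T)
  InD⇒Wheeler D = record
    { bounds     = bounds
    ; monotone   = monotone
    ; increasing = increasing
    ; reached    = reached
    }
    where
    open InD D
    bounds : ∀ a {x} → x ∈ᶜ columnsOf T !! a → 1 < x × x ≤ n
    bounds a {x} (i , e) with columnsOf-!⁻¹ T a i e
    ... | a' , u , refl , refl , e' =
      let 1≤x , x≤n = targets u a' x e' in incoming⇒ x 1≤x x≤n (u , a' , e') , x≤n

    monotone : ∀ a → Monotone (columnsOf T !! a)
    monotone a {i} {j} {x} {y} i<j e e' with columnsOf-!⁻¹ T a i e | columnsOf-!⁻¹ T a j e'
    ... | a₁ , u , refl , refl , e₁ | a₂ , u' , a₂≡a₁ , refl , e₂ with toℕ-injective a₂≡a₁ | x ≟ y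
    ... | refl | yes refl = ≤-refl
    ... | refl | no x≢y   = <⇒≤ (wheeler₂ u u' a₁ x y e₁ e₂ x≢y (s≤s i<j))

    increasing : ∀ {a a' x y} → a < a' → x ∈ᶜ columnsOf T !! a → y ∈ᶜ columnsOf T !! a' → x < y
    increasing {a} {a'} {x} {y} a<a' (i , e) (j , e')
      with columnsOf-!⁻¹ T a i e | columnsOf-!⁻¹ T a' j e'
    ... | a₁ , u , refl , refl , e₁ | a₂ , u' , refl , refl , e₂ = wheeler₁ u u' a₁ a₂ x y e₁ e₂ a<a'

    reached : ∀ {x} → 1 < x → x ≤ n → ∃[ a ] x ∈ᶜ columnsOf T !! a
    reached {x} 1<x x≤n = let u , a , e = incoming⇐ x 1<x x≤n in toℕ a , ∈-columnsOf e

  Wheeler⇒InD : Wheeler 1 n (columnsOf T) → numTrans T ≡ m →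
                (∀ a → ∃[ u ] ∃[ x ] entry T u a ≡ just x) → InD n m σ T
  Wheeler⇒InD W size effective = record
    { targets   = λ u a x e → let 1<x , x≤n = bounds (toℕ a) (∈-columnsOf e) in <⇒≤ 1<x , x≤n
    ; size      = size
    ; effective = effective
    ; incoming⇒ = λ { x _ _ (u , a , e) → proj₁ (bounds (toℕ a) (∈-columnsOf e)) }
    ; incoming⇐ = incoming⇐
    ; wheeler₁  = λ u v a a' u' v' e e' a<a' → increasing a<a' (∈-columnsOf e) (∈-columnsOf e')
    ; wheeler₂  = λ u v a u' v' e e' u'≢v' u<v →
        ≤∧≢⇒< (monotone (toℕ a) (≤-pred u<v) (trans (columnsOf-! T u a) e) (trans (columnsOf-! T v a) e'))
              u'≢v'
    }
    where
    open Wheeler W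
    incoming⇐ : ∀ x → 1 < x → x ≤ n → ∃[ u ] ∃[ a ] entry T u a ≡ just x
    incoming⇐ x 1<x x≤n with reached 1<x x≤n
    ... | a , i , e with columnsOf-!⁻¹ T a i e
    ... | a' , u , _ , _ , e' = u , a' , e'

-- Choices and the fibres of the procedure

1+σ+[n∸σ∸1]≡n : ∀ {n σ} → σ < n → suc (σ + (n ∸ σ ∸ 1)) ≡ n
1+σ+[n∸σ∸1]≡n {n} {σ} σ<n =
  trans (cong (suc σ +_) (trans (∸-+-assoc n σ 1) (cong (n ∸_) (+-comm σ 1)))) (m+[n∸m]≡n σ<n)

[n∸σ∸1]+[m+1∸n]≡s : ∀ {n m σ s} → σ < n → n ≤ suc m → s + σ ≡ m →
                    (n ∸ σ ∸ 1) + (m + 1 ∸ n) ≡ s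
[n∸σ∸1]+[m+1∸n]≡s {suc n} {m} {zero}  {s} _ n≤1+m refl
  rewrite +-identityʳ s | +-comm s 1 = m+[n∸m]≡n (≤-pred n≤1+m)
[n∸σ∸1]+[m+1∸n]≡s {suc n} {suc m} {suc σ} {s} (s≤s σ<n) n≤1+m eq =
  [n∸σ∸1]+[m+1∸n]≡s σ<n (≤-pred n≤1+m) (suc-injective (trans (sym (+-suc s σ)) eq))
[n∸σ∸1]+[m+1∸n]≡s {suc n} {zero}  {suc σ} {s} _ _ eq = ⊥-elim (m+1+n≢0 s eq)

module _ {n m σ : ℕ} (σ<n : σ < n) (n≤1+m : n ≤ suc m) where

  choice-mask-length : (c : Choice n m σ) →
                       length (Choice.b c) ≡ sum (map (λ col → ones col ∸ 1) (columns n σ (Choice.w c)))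
  choice-mask-length (choice w w-len w-ones w-cols _ b-len _) =
    trans b-len ([n∸σ∸1]+[m+1∸n]≡s σ<n n≤1+m (begin
      sum (map (λ col → ones col ∸ 1) cols) + σ
        ≡⟨ cong (sum (map (λ col → ones col ∸ 1) cols) +_) (length-columns n σ w) ⟨
      sum (map (λ col → ones col ∸ 1) cols) + length cols
        ≡⟨ sum-∸1 cols w-cols ⟩
      sum (map ones cols)
        ≡⟨ ones-columns n σ w w-len ⟩
      ones w
        ≡⟨ w-ones ⟩
      m ∎))
    where
    open ≡-Reasoning
    cols : List (List Bool)
    cols = columns n σ w

  Layout-ends-at-n : Layout 1 M v B → length M ≡ σ → ones B ≡ n ∸ σ ∸ 1 → v ≡ n
  Layout-ends-at-n l length-M ones-B rewrite Layout-final l | length-M | ones-B = 1+σ+[n∸σ∸1]≡n σ<n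

  Layout-mask : Layout 1 M n B → length M ≡ σ → sum (map (ones ∘ support) M) ≡ m →
                length B ≡ (n ∸ σ ∸ 1) + (m + 1 ∸ n) × ones B ≡ n ∸ σ ∸ 1
  Layout-mask {B = B} l length-M transitions =
    sym ([n∸σ∸1]+[m+1∸n]≡s σ<n n≤1+m
          (trans (cong (length B +_) (sym length-M)) (trans (Layout-length l) transitions))) ,
    +-cancelˡ-≡ (suc σ) _ _
      (trans (cong (λ k → suc k + ones B) (sym length-M))
             (trans (sym (Layout-final l)) (sym (1+σ+[n∸σ∸1]≡n σ<n))))

  choice-layout : (c : Choice n m σ) →
                  Layout 1 (columnsOf (run c)) n (Choice.b c)
                  × map support (columnsOf (run c)) ≡ columns n σ (Choice.w c)
  choice-layout c@(choice w w-len _ w-cols b _ b-ones)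
    with M , _ , l , support-M ← layout-with-support 1 (columns n σ w) b w-cols (choice-mask-length c)
    rewrite columnsOf-output w-len l support-M
    = subst (λ v → Layout 1 M v b)
            (Layout-ends-at-n l (proj₁ (shape-from-support M support-M w-len)) b-ones) l ,
      support-M

  run-∈D : (c : Choice n m σ) → InD n m σ (run c)
  run-∈D c = Wheeler⇒InD (Layout⇒Wheeler layout) size effective
    where
    open Choice c
    layout : Layout 1 (columnsOf (run c)) n b
    layout = proj₁ (choice-layout c)
    support-eq : map support (columnsOf (run c)) ≡ columns n σ w
    support-eq = proj₂ (choice-layout c)

    size : numTrans (run c) ≡ m
    size = begin
      numTrans (run c)                                  ≡⟨ numTrans-columnsOf (run c) ⟩
      sum (map (ones ∘ support) (columnsOf (run c)))    ≡⟨ cong sum (map-∘ (columnsOf (run c))) ⟩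
      sum (map ones (map support (columnsOf (run c))))  ≡⟨ cong (sum ∘ map ones) support-eq ⟩
      sum (map ones (columns n σ w))                    ≡⟨ ones-columns n σ w w-len ⟩
      ones w                                            ≡⟨ w-ones ⟩
      m                                                 ∎
      where open ≡-Reasoning

    effective : ∀ a → ∃[ u ] ∃[ x ] entry (run c) u a ≡ just x
    effective a =
      let x , i , e = ones-support⇒∈ᶜ (column (run c) a)
                        (tabulate⁻ (map⁻ (subst (All (λ col → 1 ≤ ones col)) (sym support-eq) w-cols)) a)
          u , _ , e' = tabulate-!⁻¹ (λ u → entry (run c) u a) i e
      in u , x , e'

  Choice-≡ : ∀ {c₁ c₂ : Choice n m σ} → Choice.w c₁ ≡ Choice.w c₂ → Choice.b c₁ ≡ Choice.b c₂ →
             c₁ ≡ c₂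
  Choice-≡ {choice w l₁ o₁ p₁ b k₁ q₁} {choice w l₂ o₂ p₂ b k₂ q₂} refl refl
    rewrite ≡-irrelevant l₁ l₂ | ≡-irrelevant o₁ o₂ | All.irrelevant ≤-irrelevant p₁ p₂
          | ≡-irrelevant k₁ k₂ | ≡-irrelevant q₁ q₂
    = refl

  run-injective : ∀ (c₁ c₂ : Choice n m σ) → run c₁ ≡ run c₂ → c₁ ≡ c₂
  run-injective c₁ c₂ run-eq = Choice-≡ w-eq b-eq
    where
    open Choice
    b-eq : b c₁ ≡ b c₂
    b-eq = proj₁ (Layout-deterministic
             (subst (λ T → Layout 1 (columnsOf T) n (b c₁)) run-eq (proj₁ (choice-layout c₁)))
             (proj₁ (choice-layout c₂)))
    columns-eq : columns n σ (w c₁) ≡ columns n σ (w c₂)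
    columns-eq = trans (sym (proj₂ (choice-layout c₁)))
                       (trans (cong (map support ∘ columnsOf) run-eq) (proj₂ (choice-layout c₂)))
    w-eq : w c₁ ≡ w c₂
    w-eq = trans (sym (concat-columns n σ (w c₁) (w-len c₁)))
                 (trans (cong concat columns-eq) (concat-columns n σ (w c₂) (w-len c₂)))

  Fiber-irrelevant : ∀ T (f g : Fiber n m σ T) → f ≡ g
  Fiber-irrelevant T (c₁ , e₁) (c₂ , e₂) with run-injective c₁ c₂ (trans e₁ (sym e₂))
  ... | refl = cong (c₁ ,_) (uip e₁ e₂)

  preimage : ∀ T → InD n m σ T → Fiber n m σ T
  preimage T D = choice (patternOf T) (length-patternOf T) w-ones w-cols b (proj₁ b-shape) (proj₂ b-shape) , run≡T
    where
    open InD D using (size; effective)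
    nonempty : All (λ c → ∃[ x ] x ∈ᶜ c) (columnsOf T)
    nonempty = effective⇒nonempty T effective

    b : List Bool
    b = proj₁ (Wheeler⇒Layout (columnsOf T) (≤-trans (s≤s z≤n) σ<n) (InD⇒Wheeler D) nonempty)
    layout : Layout 1 (columnsOf T) n b
    layout = proj₂ (Wheeler⇒Layout (columnsOf T) (≤-trans (s≤s z≤n) σ<n) (InD⇒Wheeler D) nonempty)

    w-ones : ones (patternOf T) ≡ m
    w-ones = trans (ones-patternOf T) size
    w-cols : All (λ col → 1 ≤ ones col) (columns n σ (patternOf T))
    w-cols = subst (All (λ col → 1 ≤ ones col)) (sym (columns-patternOf T))
                   (map⁺ (All.map (λ {c} (_ , p) → ∈ᶜ⇒ones-support c p) nonempty))

    b-shape : length b ≡ (n ∸ σ ∸ 1) + (m + 1 ∸ n) × ones b ≡ n ∸ σ ∸ 1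
    b-shape = Layout-mask layout (length-tabulate (column T)) (trans (sym (numTrans-columnsOf T)) size)

    run≡T : output n σ (patternOf T) b ≡ T
    run≡T = table-ext λ u a →
      trans (output-entry layout (sym (columns-patternOf T)) u a) (columnsOf-! T u a)

lemma16 : (n m σ : ℕ) → n ≤ suc m → m ≤ n * σ → σ < n →
    ((c : Choice n m σ) → InD n m σ (run c))
    × ((T T' : Table n σ) → InD n m σ T → InD n m σ T' →
    Fiber n m σ T ↔ Fiber n m σ T')
lemma16 n m σ n≤1+m _ σ<n = run-∈D σ<n n≤1+m , λ T T' T∈D T'∈D →
  mk↔ₛ′ (λ _ → preimage σ<n n≤1+m T' T'∈D) (λ _ → preimage σ<n n≤1+m T T∈D)
        (Fiber-irrelevant σ<n n≤1+m T' _) (Fiber-irrelevant σ<n n≤1+m T _)
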